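{- Let $h \ge 2$ and $k \ge 3$ be integers, and let $b$ be an integer. If $b > h(k-2)$, then the set $A = [0,k-2] \cup \{b\}$ satisfies \[ |hA| = (h+1)\left(1 + \frac{h(k-2)}{2}\right). \] If $b \in [k-1, h(k-2)]$, then there exist unique integers $i_0 \in [0,h-2]$ and $r \in [0,k-3]$ such that $b = (h-i_0)(k-2) - r$, and the set $A = [0,k-2]\cup\{b\}$ satisfies \[ |hA| = (i_0+1)b + (h-i_0)(h(k-2)+1) - \frac{(h+i_0+1)(h-i_0)(k-2)}{2}. \]
   Context: For real numbers $u\le v$, $[u,v]$ denotes the integer interval $\{n\in\mathbf{Z}: u\le n\le v\}$. For a nonempty set $A$ of integers and a positive integer $h$, $hA$ denotes the set of all sums of $h$ not necessarily distinct elements of $A$. -}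

module Defs where

open import Data.Nat using (ℕ)
open import Data.Integer using (ℤ; +_; _+_; _-_; _*_; _≤_)
open import Data.List using (List; length)
open import Data.List.Membership.Propositional using (_∈_)
open import Data.List.Relation.Unary.Unique.Propositional using (Unique)
open import Data.Vec using (Vec)
import Data.Vec as V
open import Data.Vec.Relation.Unary.All using (All)
open import Data.Product using (Σ; _×_; ∃)
open import Data.Sum using (_⊎_)
open import Function.Bundles using (_⇔_)
open import Relation.Binary.PropositionalEquality using (_≡_)

ISet : Set₁
ISet = ℤ → Set

Interval : ℤ → ℤ → ISet
Interval u v n = (u ≤ n) × (n ≤ v)

_∪_ : ISet → ISet → ISet
(S ∪ T) n = S n ⊎ T n

｛_｝ : ℤ → ISet
｛ b ｝ n = n ≡ b

vsum : ∀ {h} → Vec ℤ h → ℤ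
vsum = V.foldr _ _+_ (+ 0)

sumset : ℕ → ISet → ISet
sumset h A n = ∃ λ (xs : Vec ℤ h) → All A xs × vsum xs ≡ n

HasSize : ISet → ℕ → Set
HasSize S m = Σ (List ℤ) λ xs → Unique xs × length xs ≡ m × (∀ n → (n ∈ xs) ⇔ S n)

{-# OPTIONS --safe #-}
module Submission where

-- For A = [0,n] ∪ {b} (n = k - 2), an (h+1)-fold sum either avoids b, and then it can be any
-- point of [0,(h+1)n], or contains b, so (h+1)A = [0,(h+1)n] ∪ (b + hA).  When h n < b the two
-- pieces are disjoint at every level and |hA| = Σ_{c ≤ h} (c n + 1).  Otherwise round b up to a
-- multiple of n, b + r = q n with 0 ≤ r < n and 2 ≤ q ≤ h.  The first q - 1 levels are still
-- disjoint, but from level q on, b ≤ q n makes the new initial interval overlap the translate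
-- of the previous one, and the two merge into the disjoint decomposition
--   hA = [0, (h-q+1) b + (q-1) n] ∪ ((h-q+2) b + (q-2)A).
-- Counting both parts with i₀ = h - q gives the formula; (i₀, r) is unique because rounding
-- up to a multiple of n is.

module Sumsets where

  open import Defs
  open import Level using (0ℓ) renaming (suc to lsuc)
  open import Function.Base using (_∘_)
  open import Function.Bundles using (Equivalence; mk⇔)
  open import Data.Nat
  open import Data.Nat.Properties
  open import Data.Integer as ℤ using (ℤ; +_; +≤+) renaming (_≤_ to _≤ℤ_)
  import Data.Integer.Properties as ℤₚ
  open import Algebra.Bundles using (AbelianGroup)
  open import Algebra.Properties.CommutativeSemigroup ℤₚ.+-commutativeSemigroup
    using (x∙yz≈y∙xz)
  open import Algebra.Properties.Group (AbelianGroup.group ℤₚ.+-0-abelianGroup)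
    using (∙-cancelˡ)
  open import Data.List using (_++_; map; upTo)
  open import Data.List.Properties using (length-++; length-map; length-upTo)
  open import Data.List.Membership.Propositional using (_∈_)
  open import Data.List.Membership.Propositional.Properties
    using (∈-++⁺ˡ; ∈-++⁺ʳ; ∈-++⁻; ∈-map⁺; ∈-map⁻; ∈-upTo⁺; ∈-upTo⁻)
  import Data.List.Relation.Unary.Unique.Propositional.Properties as Unique
  open import Data.Vec using (Vec; []; _∷_)
  open import Data.Vec.Relation.Unary.All as All using (All; []; _∷_)
  open import Data.Product using (∃; _×_; _,_; map₁; map₂)
  open import Data.Sum as Sum using (inj₁; inj₂; [_,_])
  open import Relation.Nullary using (¬_; yes; no)
  open import Relation.Unary using (_⊆_; _≐_; _⊥_)
  open import Relation.Unary.Properties using (≐-refl; ≐-sym; ≐-trans)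
  open import Relation.Binary.Bundles using (Setoid)
  open import Relation.Binary.PropositionalEquality
    using (_≡_; refl; sym; trans; cong; subst)
  import Relation.Binary.Reasoning.Setoid as SetoidReasoning

  open Equivalence using (to; from)

  translate : ℕ → ISet → ISet
  translate c S x = ∃ λ y → S y × x ≡ + c ℤ.+ y

  ≐-setoid : Setoid (lsuc 0ℓ) 0ℓ
  ≐-setoid = record
    { Carrier       = ISet
    ; _≈_           = _≐_
    ; isEquivalence = record { refl = ≐-refl ; sym = ≐-sym ; trans = ≐-trans }
    }

  ∪-congˡ : ∀ {S T T′} → T ≐ T′ → S ∪ T ≐ S ∪ T′
  ∪-congˡ (T⊆T′ , T′⊆T) = Sum.map₂ T⊆T′ , Sum.map₂ T′⊆T

  translate-cong : ∀ {c S T} → S ≐ T → translate c S ≐ translate c T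
  translate-cong (S⊆T , T⊆S) = map₂ (map₁ S⊆T) , map₂ (map₁ T⊆S)

  translate-translate : ∀ {b c S} → translate b (translate c S) ≐ translate (b + c) S
  translate-translate {b} {c} =
    (λ { (_ , (z , Sz , refl) , refl) → z , Sz , sym (ℤₚ.+-assoc (+ b) (+ c) z) }) ,
    (λ { (z , Sz , refl) → + c ℤ.+ z , (z , Sz , refl) , ℤₚ.+-assoc (+ b) (+ c) z })

  HasSize-cong : ∀ {S T m} → S ≐ T → HasSize S m → HasSize T m
  HasSize-cong (S⊆T , T⊆S) (xs , xs! , len , xs⇔S) =
    xs , xs! , len , λ x → mk⇔ (S⊆T ∘ to (xs⇔S x)) (from (xs⇔S x) ∘ T⊆S)

  HasSize-∪ : ∀ {S T m m′} → S ⊥ T → HasSize S m → HasSize T m′ → HasSize (S ∪ T) (m + m′)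
  HasSize-∪ S⊥T (xs , xs! , refl , xs⇔S) (ys , ys! , refl , ys⇔T) =
    xs ++ ys , Unique.++⁺ xs! ys! disjoint , length-++ xs ,
    λ x → mk⇔ (Sum.map (to (xs⇔S x)) (to (ys⇔T x)) ∘ ∈-++⁻ xs)
              [ ∈-++⁺ˡ ∘ from (xs⇔S x) , ∈-++⁺ʳ xs ∘ from (ys⇔T x) ]
    where
    disjoint : ∀ {x} → ¬ (x ∈ xs × x ∈ ys)
    disjoint (x∈xs , x∈ys) = S⊥T (to (xs⇔S _) x∈xs , to (ys⇔T _) x∈ys)

  HasSize-translate : ∀ {S m} c → HasSize S m → HasSize (translate c S) m
  HasSize-translate c (xs , xs! , len , xs⇔S) =
    map (ℤ._+_ (+ c)) xs , Unique.map⁺ (∙-cancelˡ (+ c) _ _) xs! ,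
    trans (length-map _ xs) len ,
    λ x → mk⇔ (λ x∈ → let y , y∈xs , x≡ = ∈-map⁻ (ℤ._+_ (+ c)) x∈ in
                      y , to (xs⇔S y) y∈xs , x≡)
              (λ { (y , Sy , refl) → ∈-map⁺ (ℤ._+_ (+ c)) (from (xs⇔S y) Sy) })

  HasSize-Interval : ∀ M → HasSize (Interval (+ 0) (+ M)) (suc M)
  HasSize-Interval M =
    map +_ (upTo (suc M)) , Unique.map⁺ ℤₚ.+-injective (Unique.upTo⁺ (suc M)) ,
    trans (length-map +_ (upTo (suc M))) (length-upTo (suc M)) ,
    λ x → mk⇔ (λ x∈ → let y , y∈ , x≡ = ∈-map⁻ +_ x∈ in
                      subst (Interval (+ 0) (+ M)) (sym x≡)
                        (+≤+ z≤n , +≤+ (s≤s⁻¹ (∈-upTo⁻ y∈))))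
              (λ { (+≤+ z≤n , +≤+ y≤M) → ∈-map⁺ +_ (∈-upTo⁺ (s≤s y≤M)) })

  Interval-+ : ∀ {M M′ x y} → Interval (+ 0) (+ M) x → Interval (+ 0) (+ M′) y →
               Interval (+ 0) (+ (M + M′)) (x ℤ.+ y)
  Interval-+ (+≤+ z≤n , +≤+ x≤M) (+≤+ z≤n , +≤+ y≤M′) = +≤+ z≤n , +≤+ (+-mono-≤ x≤M y≤M′)

  Interval⊥translate : ∀ {M c T} → M < c → T ⊆ (+ 0 ≤ℤ_) → Interval (+ 0) (+ M) ⊥ translate c T
  Interval⊥translate {c = c} M<c T≥0 ((_ , x≤M) , (y , Ty , refl)) with T≥0 Ty | x≤M
  ... | +≤+ z≤n | +≤+ c+y≤M = <⇒≱ M<c (≤-trans (m≤m+n c _) c+y≤M)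

  Interval-∪-translate-overlap : ∀ {b M M′ T} → b ≤ suc M → M ≤ b + M′ →
    Interval (+ 0) (+ M) ∪ translate b (Interval (+ 0) (+ M′) ∪ T)
      ≐ Interval (+ 0) (+ (b + M′)) ∪ translate b T
  Interval-∪-translate-overlap {b} {M} {M′} {T} b≤1+M M≤b+M′ = merge , split
    where
    merge : Interval (+ 0) (+ M) ∪ translate b (Interval (+ 0) (+ M′) ∪ T)
              ⊆ Interval (+ 0) (+ (b + M′)) ∪ translate b T
    merge (inj₁ (0≤x , +≤+ x≤M)) = inj₁ (0≤x , +≤+ (≤-trans x≤M M≤b+M′))
    merge (inj₂ (_ , inj₁ (+≤+ z≤n , +≤+ y≤M′) , refl)) = inj₁ (+≤+ z≤n , +≤+ (+-monoʳ-≤ b y≤M′))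
    merge (inj₂ (y , inj₂ Ty , x≡)) = inj₂ (y , Ty , x≡)
    split : Interval (+ 0) (+ (b + M′)) ∪ translate b T
              ⊆ Interval (+ 0) (+ M) ∪ translate b (Interval (+ 0) (+ M′) ∪ T)
    split (inj₁ (+≤+ {n = x} z≤n , +≤+ x≤b+M′)) with x ≤? M
    ... | yes x≤M = inj₁ (+≤+ z≤n , +≤+ x≤M)
    ... | no x≰M = inj₂ (+ (x ∸ b) , inj₁ (+≤+ z≤n , +≤+ (m≤n+o⇒m∸n≤o x b x≤b+M′)) ,
                         cong +_ (sym (m+[n∸m]≡n (≤-trans b≤1+M (≰⇒> x≰M)))))
    split (inj₂ (y , Ty , x≡)) = inj₂ (y , inj₂ Ty , x≡)

  sumset-zero : ∀ {S} → sumset 0 S ≐ Interval (+ 0) (+ 0)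
  sumset-zero = (λ { ([] , [] , refl) → +≤+ z≤n , +≤+ z≤n }) ,
                (λ { (+≤+ z≤n , +≤+ z≤n) → [] , [] , refl })

  sumset-mono : ∀ {h S T} → S ⊆ T → sumset h S ⊆ sumset h T
  sumset-mono S⊆T (xs , xs∈S , sum≡) = xs , All.map S⊆T xs∈S , sum≡

  vsum-nonneg : ∀ {h} {xs : Vec ℤ h} → All (+ 0 ≤ℤ_) xs → + 0 ≤ℤ vsum xs
  vsum-nonneg []           = +≤+ z≤n
  vsum-nonneg (x≥0 ∷ xs≥0) = ℤₚ.+-mono-≤ x≥0 (vsum-nonneg xs≥0)

  sumset-nonneg : ∀ {h S} → S ⊆ (+ 0 ≤ℤ_) → sumset h S ⊆ (+ 0 ≤ℤ_)
  sumset-nonneg S≥0 (_ , xs∈S , refl) = vsum-nonneg (All.map S≥0 xs∈S)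

  Interval⊆sumset : ∀ n h → Interval (+ 0) (+ (h * n)) ⊆ sumset h (Interval (+ 0) (+ n))
  Interval⊆sumset n zero    (+≤+ z≤n , +≤+ z≤n) = [] , [] , refl
  Interval⊆sumset n (suc h) (+≤+ {n = x} z≤n , +≤+ x≤n+hn)
    with ys , ys∈ , ys≡ ← Interval⊆sumset n h (+≤+ z≤n , +≤+ (m≤n+o⇒m∸n≤o x n x≤n+hn)) =
    + (n ⊓ x) ∷ ys , (+≤+ z≤n , +≤+ (m⊓n≤m n x)) ∷ ys∈ ,
    trans (cong (ℤ._+_ (+ (n ⊓ x))) ys≡) (cong +_ (m⊓n+n∸m≡n n x))

  separatedSize : ℕ → ℕ → ℕ
  separatedSize n zero    = 1
  separatedSize n (suc h) = suc (suc h * n) + separatedSize n h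

  module IntervalWithPoint (n b : ℕ) where

    A : ISet
    A = Interval (+ 0) (+ n) ∪ ｛ + b ｝

    A-nonneg : A ⊆ (+ 0 ≤ℤ_)
    A-nonneg (inj₁ (0≤x , _)) = 0≤x
    A-nonneg (inj₂ refl)      = +≤+ z≤n

    sumset-suc⁻ : ∀ h →
      sumset (suc h) A ⊆ Interval (+ 0) (+ (suc h * n)) ∪ translate b (sumset h A)
    sumset-suc⁻ h (_ ∷ xs , inj₂ refl ∷ xs∈ , refl) =
      inj₂ (vsum xs , (xs , xs∈ , refl) , refl)
    sumset-suc⁻ zero (_ ∷ [] , inj₁ x∈ ∷ [] , refl) =
      inj₁ (Interval-+ x∈ (+≤+ z≤n , +≤+ z≤n))
    sumset-suc⁻ (suc h) (x ∷ xs , inj₁ x∈ ∷ xs∈ , refl) with sumset-suc⁻ h (xs , xs∈ , refl)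
    ... | inj₁ sum∈ = inj₁ (Interval-+ x∈ sum∈)
    ... | inj₂ (_ , (ys , ys∈ , refl) , sum≡) =
      inj₂ (x ℤ.+ vsum ys , (x ∷ ys , inj₁ x∈ ∷ ys∈ , refl) ,
            trans (cong (ℤ._+_ x) sum≡) (x∙yz≈y∙xz x (+ b) (vsum ys)))

    sumset-suc : ∀ h →
      sumset (suc h) A ≐ Interval (+ 0) (+ (suc h * n)) ∪ translate b (sumset h A)
    sumset-suc h = sumset-suc⁻ h , [ sumset-mono inj₁ ∘ Interval⊆sumset n (suc h) , add-b ]
      where
      add-b : translate b (sumset h A) ⊆ sumset (suc h) A
      add-b (_ , (ys , ys∈ , refl) , refl) = + b ∷ ys , inj₂ refl ∷ ys∈ , refl

    sumset-size-separated : ∀ h → h * n < b → HasSize (sumset h A) (separatedSize n h)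
    sumset-size-separated zero    _       = HasSize-cong (≐-sym sumset-zero) (HasSize-Interval 0)
    sumset-size-separated (suc h) 1+h*n<b =
      HasSize-cong (≐-sym (sumset-suc h))
        (HasSize-∪ (Interval⊥translate 1+h*n<b (sumset-nonneg A-nonneg))
          (HasSize-Interval (suc h * n))
          (HasSize-translate b (sumset-size-separated h (≤-<-trans (m≤n+m (h * n) n) 1+h*n<b))))

    module _ {u} (1+u*n<b : suc u * n < b) (b≤2+u*n : b ≤ suc (suc u) * n) where

      n≤b : n ≤ b
      n≤b = ≤-trans (m≤m+n n (u * n)) (<⇒≤ 1+u*n<b)

      overlap-bound : ∀ p → suc (p + suc u) * n ≤ b + (p * b + suc u * n)
      overlap-bound p = begin
        suc (p + suc u) * n        ≡⟨ *-distribʳ-+ n (suc p) (suc u) ⟩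
        suc p * n + suc u * n      ≤⟨ +-monoˡ-≤ (suc u * n) (*-monoʳ-≤ (suc p) n≤b) ⟩
        suc p * b + suc u * n      ≡⟨ +-assoc b (p * b) (suc u * n) ⟩
        b + (p * b + suc u * n)    ∎
        where open ≤-Reasoning

      sumset-overlapping : ∀ p → sumset (p + suc u) A
        ≐ Interval (+ 0) (+ (p * b + suc u * n)) ∪ translate (suc p * b) (sumset u A)
      sumset-overlapping zero = begin
        sumset (suc u) A
          ≈⟨ sumset-suc u ⟩
        Interval (+ 0) (+ (suc u * n)) ∪ translate b (sumset u A)
          ≡⟨ cong (λ c → Interval (+ 0) (+ (suc u * n)) ∪ translate c (sumset u A))
               (sym (*-identityˡ b)) ⟩
        Interval (+ 0) (+ (suc u * n)) ∪ translate (1 * b) (sumset u A) ∎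
        where open SetoidReasoning ≐-setoid
      sumset-overlapping (suc p) = begin
        sumset (suc (p + suc u)) A
          ≈⟨ sumset-suc (p + suc u) ⟩
        Interval (+ 0) (+ M) ∪ translate b (sumset (p + suc u) A)
          ≈⟨ ∪-congˡ (translate-cong (sumset-overlapping p)) ⟩
        Interval (+ 0) (+ M)
          ∪ translate b (Interval (+ 0) (+ M′) ∪ translate (suc p * b) (sumset u A))
          ≈⟨ Interval-∪-translate-overlap b≤1+M (overlap-bound p) ⟩
        Interval (+ 0) (+ (b + M′)) ∪ translate b (translate (suc p * b) (sumset u A))
          ≈⟨ ∪-congˡ translate-translate ⟩
        Interval (+ 0) (+ (b + M′)) ∪ translate (suc (suc p) * b) (sumset u A)
          ≡⟨ cong (λ c → Interval (+ 0) (+ c) ∪ translate (suc (suc p) * b) (sumset u A))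
               (sym (+-assoc b (p * b) (suc u * n))) ⟩
        Interval (+ 0) (+ (suc p * b + suc u * n)) ∪ translate (suc (suc p) * b) (sumset u A) ∎
        where
        open SetoidReasoning ≐-setoid
        M M′ : ℕ
        M  = suc (p + suc u) * n
        M′ = p * b + suc u * n
        b≤1+M : b ≤ suc M
        b≤1+M = ≤-trans b≤2+u*n (≤-trans (*-monoˡ-≤ n (s≤s (m≤n+m (suc u) p))) (n≤1+n M))

      sumset-size-overlapping : ∀ p →
        HasSize (sumset (p + suc u) A) (suc (p * b + suc u * n) + separatedSize n u)
      sumset-size-overlapping p =
        HasSize-cong (≐-sym (sumset-overlapping p))
          (HasSize-∪ (Interval⊥translate M<1+p*b (sumset-nonneg A-nonneg))
            (HasSize-Interval (p * b + suc u * n))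
            (HasSize-translate (suc p * b)
              (sumset-size-separated u (≤-<-trans (m≤n+m (u * n) n) 1+u*n<b))))
        where
        M<1+p*b : p * b + suc u * n < suc p * b
        M<1+p*b = subst (p * b + suc u * n <_) (+-comm (p * b) b) (+-monoʳ-< (p * b) 1+u*n<b)

module RoundingUp where

  open import Data.Nat
  open import Data.Nat.Properties
  open import Data.Product using (∃₂; _×_; _,_)
  open import Relation.Binary.PropositionalEquality using (_≡_; refl; sym; trans; cong)

  roundUp-exists : ∀ n b → ∃₂ λ q r → r < suc n × b + r ≡ q * suc n
  roundUp-exists n zero = 0 , 0 , s≤s z≤n , refl
  roundUp-exists n (suc b) with roundUp-exists n b
  ... | q , suc r , 1+r<1+n , b+1+r≡q*1+n =
    q , r , <⇒≤ 1+r<1+n , trans (sym (+-suc b r)) b+1+r≡q*1+n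
  ... | q , zero , _ , b+0≡q*1+n =
    suc q , n , ≤-refl , cong suc (trans (cong (_+ n) (trans (sym (+-identityʳ b)) b+0≡q*1+n))
                                         (+-comm (q * suc n) n))

  roundUp-minimal : ∀ {n b q r q′} → r < n → b + r ≡ q * n → b ≤ q′ * n → q ≤ q′
  roundUp-minimal {n} {b} {q} {r} {q′} r<n b+r≡q*n b≤q′*n =
    s≤s⁻¹ (*-cancelʳ-< n q (suc q′) (begin-strict
      q * n      ≡⟨ sym b+r≡q*n ⟩
      b + r      <⟨ +-monoʳ-< b r<n ⟩
      b + n      ≤⟨ +-monoˡ-≤ n b≤q′*n ⟩
      q′ * n + n ≡⟨ +-comm (q′ * n) n ⟩
      suc q′ * n ∎))
    where open ≤-Reasoning

  roundUp-exceeds : ∀ {n b q r q′} → q′ * n < b → b + r ≡ q * n → q′ < q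
  roundUp-exceeds {n} {b} {q} {r} {q′} q′*n<b b+r≡q*n =
    *-cancelʳ-< n q′ q (<-≤-trans q′*n<b (≤-trans (m≤m+n b r) (≤-reflexive b+r≡q*n)))

  roundUp-pred-below : ∀ {n b q r} → r < n → b + r ≡ suc q * n → q * n < b
  roundUp-pred-below {q = q} r<n b+r≡1+q*n =
    ≰⇒> (λ b≤q*n → n≮n q (roundUp-minimal r<n b+r≡1+q*n b≤q*n))

  roundUp-unique : ∀ {n b q r q′ r′} → r < n → r′ < n → b + r ≡ q * n → b + r′ ≡ q′ * n →
                   q ≡ q′ × r ≡ r′
  roundUp-unique {b = b} {q} {r} {q′} {r′} r<n r′<n b+r≡q*n b+r′≡q′*n = q≡q′ , r≡r′
    where
    q≡q′ : q ≡ q′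
    q≡q′ = ≤-antisym
      (roundUp-minimal r<n b+r≡q*n (≤-trans (m≤m+n b r′) (≤-reflexive b+r′≡q′*n)))
      (roundUp-minimal r′<n b+r′≡q′*n (≤-trans (m≤m+n b r) (≤-reflexive b+r≡q*n)))
    r≡r′ : r ≡ r′
    r≡r′ = +-cancelˡ-≡ b r r′ (trans b+r≡q*n (trans (cong (_* _) q≡q′) (sym b+r′≡q′*n)))

module ClosedForms where

  open import Data.Nat as ℕ using (ℕ; suc; _∸_)
  open import Data.Integer hiding (suc)
  open import Data.Integer.Properties
  open import Data.Integer.Tactic.RingSolver using (solve-∀)
  open import Function.Bundles using (_⇔_; mk⇔)
  open import Relation.Binary.PropositionalEquality
    using (_≡_; refl; sym; trans; cong; cong₂; module ≡-Reasoning)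
  open ≡-Reasoning
  open Sumsets using (separatedSize)

  separatedSize-closed : ∀ n h → + 2 * + separatedSize n h ≡ (+ h + + 1) * (+ 2 + + h * + n)
  separatedSize-closed n ℕ.zero    = refl
  separatedSize-closed n (suc h) = begin
    + 2 * + (suc (suc h ℕ.* n) ℕ.+ separatedSize n h)
      ≡⟨ cong (+ 2 *_) (pos-+ (suc (suc h ℕ.* n)) (separatedSize n h)) ⟩
    + 2 * (+ 1 + + (suc h ℕ.* n) + + separatedSize n h)
      ≡⟨ *-distribˡ-+ (+ 2) (+ 1 + + (suc h ℕ.* n)) (+ separatedSize n h) ⟩
    + 2 * (+ 1 + + (suc h ℕ.* n)) + + 2 * + separatedSize n h
      ≡⟨ cong₂ (λ x y → + 2 * (+ 1 + x) + y) (pos-* (suc h) n) (separatedSize-closed n h) ⟩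
    + 2 * (+ 1 + (+ 1 + + h) * + n) + (+ h + + 1) * (+ 2 + + h * + n)
      ≡⟨ identity (+ h) (+ n) ⟩
    (+ 1 + + h + + 1) * (+ 2 + (+ 1 + + h) * + n) ∎
    where
    identity : ∀ h n → + 2 * (+ 1 + (+ 1 + h) * n) + (h + + 1) * (+ 2 + h * n)
                         ≡ (+ 1 + h + + 1) * (+ 2 + (+ 1 + h) * n)
    identity = solve-∀

  overlappingSize-closed : ∀ n b i₀ u {h} → h ≡ suc i₀ ℕ.+ suc u →
    + 2 * + (suc (suc i₀ ℕ.* b ℕ.+ suc u ℕ.* n) ℕ.+ separatedSize n u)
      ≡ + 2 * (+ i₀ + + 1) * + b + + 2 * (+ h - + i₀) * (+ h * + n + + 1)
        - (+ h + + i₀ + + 1) * (+ h - + i₀) * + n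
  overlappingSize-closed n b i₀ u refl = begin
    + 2 * + (suc M ℕ.+ separatedSize n u)
      ≡⟨ cong (+ 2 *_) (pos-+ (suc M) (separatedSize n u)) ⟩
    + 2 * (+ 1 + + M + + separatedSize n u)
      ≡⟨ *-distribˡ-+ (+ 2) (+ 1 + + M) (+ separatedSize n u) ⟩
    + 2 * (+ 1 + + M) + + 2 * + separatedSize n u
      ≡⟨ cong₂ (λ x y → + 2 * (+ 1 + x) + y) pos-M (separatedSize-closed n u) ⟩
    + 2 * (+ 1 + ((+ 1 + + i₀) * + b + (+ 1 + + u) * + n)) + (+ u + + 1) * (+ 2 + + u * + n)
      ≡⟨ identity (+ i₀) (+ u) (+ b) (+ n) (pos-+ (suc i₀) (suc u)) ⟩
    _ ∎
    where
    M : ℕ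
    M = suc i₀ ℕ.* b ℕ.+ suc u ℕ.* n
    pos-M : + M ≡ (+ 1 + + i₀) * + b + (+ 1 + + u) * + n
    pos-M = trans (pos-+ (suc i₀ ℕ.* b) (suc u ℕ.* n))
                  (cong₂ _+_ (pos-* (suc i₀) b) (pos-* (suc u) n))
    polynomial : ∀ i u b n →
      + 2 * (+ 1 + ((+ 1 + i) * b + (+ 1 + u) * n)) + (u + + 1) * (+ 2 + u * n)
        ≡ + 2 * (i + + 1) * b + + 2 * (+ 1 + i + (+ 1 + u) - i) * ((+ 1 + i + (+ 1 + u)) * n + + 1)
          - (+ 1 + i + (+ 1 + u) + i + + 1) * (+ 1 + i + (+ 1 + u) - i) * n
    polynomial = solve-∀
    identity : ∀ i u b n {h} → h ≡ + 1 + i + (+ 1 + u) →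
      + 2 * (+ 1 + ((+ 1 + i) * b + (+ 1 + u) * n)) + (u + + 1) * (+ 2 + u * n)
        ≡ + 2 * (i + + 1) * b + + 2 * (h - i) * (h * n + + 1) - (h + i + + 1) * (h - i) * n
    identity i u b n refl = polynomial i u b n

  representation⇔ : ∀ {h n b i₀ r} → i₀ ℕ.≤ h →
                    (+ b ≡ (+ h - + i₀) * + n - + r) ⇔ (b ℕ.+ r ≡ (h ∸ i₀) ℕ.* n)
  representation⇔ {h} {n} {b} {i₀} {r} i₀≤h = mk⇔
    (λ b≡ → +-injective (begin
      + b + + r                       ≡⟨ cong (_+ + r) b≡ ⟩
      (+ h - + i₀) * + n - + r + + r  ≡⟨ minus-plus ((+ h - + i₀) * + n) (+ r) ⟩
      (+ h - + i₀) * + n              ≡⟨ pos-multiple ⟩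
      + ((h ∸ i₀) ℕ.* n)              ∎))
    (λ b+r≡ → begin
      + b                             ≡⟨ plus-minus (+ b) (+ r) ⟩
      + (b ℕ.+ r) - + r               ≡⟨ cong (λ x → + x - + r) b+r≡ ⟩
      + ((h ∸ i₀) ℕ.* n) - + r        ≡⟨ cong (_- + r) (sym pos-multiple) ⟩
      (+ h - + i₀) * + n - + r        ∎)
    where
    pos-multiple : (+ h - + i₀) * + n ≡ + ((h ∸ i₀) ℕ.* n)
    pos-multiple = trans (cong (_* + n) (trans (m-n≡m⊖n h i₀) (⊖-≥ i₀≤h)))
                         (sym (pos-* (h ∸ i₀) n))
    minus-plus : ∀ x y → x - y + y ≡ x
    minus-plus = solve-∀
    plus-minus : ∀ x y → x ≡ x + y - y
    plus-minus = solve-∀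

open import Defs
open import Data.Nat using (ℕ; _≤_; _∸_)
open import Data.Integer using (ℤ; +_; _+_; _-_; _*_; _<_) renaming (_≤_ to _≤ℤ_)
open import Data.Product using (Σ; _×_; ∃)
open import Relation.Binary.PropositionalEquality using (_≡_)

import Data.Nat as ℕ
import Data.Nat.Properties as ℕₚ
open import Data.Integer using (+≤+; +<+)
open import Data.Integer.Properties using (pos-*)
open import Data.Product using (_,_; proj₁; proj₂)
open import Function.Bundles using (Equivalence)
open import Relation.Binary.PropositionalEquality using (refl; sym; trans; subst)
open Sumsets
open RoundingUp
open ClosedForms
open Equivalence using (to; from)

representation-unique : ∀ {h n b i₀ r i₀′ r′} → i₀′ ≤ h → i₀ ≤ h → r′ ℕ.< n → r ℕ.< n →
  + b ≡ (+ h - + i₀) * + n - + r → + b ≡ (+ h - + i₀′) * + n - + r′ → i₀′ ≡ i₀ × r′ ≡ r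
representation-unique {h} {i₀ = i₀} {r} {i₀′} {r′} i₀′≤h i₀≤h r′<n r<n b≡ b≡′ =
  ℕₚ.∸-cancelˡ-≡ i₀′≤h i₀≤h (proj₁ same) , proj₂ same
  where
  same : h ∸ i₀′ ≡ h ∸ i₀ × r′ ≡ r
  same = roundUp-unique r′<n r<n (to (representation⇔ i₀′≤h) b≡′) (to (representation⇔ i₀≤h) b≡)

separated-case : ∀ h n b → + (h ℕ.* n) < b →
  ∃ λ (m : ℕ) → HasSize (sumset h (Interval (+ 0) (+ n) ∪ ｛ b ｝)) m
    × + 2 * + m ≡ (+ h + + 1) * (+ 2 + + h * + n)
separated-case h n _ (+<+ {n = b} h*n<b) =
  separatedSize n h , IntervalWithPoint.sumset-size-separated n b h h*n<b , separatedSize-closed n h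

overlapping-case : ∀ h n₁ b → + ℕ.suc (ℕ.suc n₁) ≤ℤ b → b ≤ℤ + (h ℕ.* ℕ.suc n₁) →
  ∃ λ (i₀ : ℕ) → ∃ λ (r : ℕ) →
    (i₀ ≤ h ∸ 2) × (r ≤ n₁)
    × b ≡ (+ h - + i₀) * + ℕ.suc n₁ - + r
    × (∀ (i₀′ r′ : ℕ) → i₀′ ≤ h ∸ 2 → r′ ≤ n₁
         → b ≡ (+ h - + i₀′) * + ℕ.suc n₁ - + r′ → (i₀′ ≡ i₀) × (r′ ≡ r))
    × ∃ λ (m : ℕ) → HasSize (sumset h (Interval (+ 0) (+ ℕ.suc n₁) ∪ ｛ b ｝)) m
        × + 2 * + m ≡ + 2 * (+ i₀ + + 1) * b + + 2 * (+ h - + i₀) * (+ h * + ℕ.suc n₁ + + 1)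
                       - (+ h + + i₀ + + 1) * (+ h - + i₀) * + ℕ.suc n₁
overlapping-case h n₁ _ (+≤+ {n = b} n<b) (+≤+ b≤h*n)
  with q , r , r<n , b+r≡q*n ← roundUp-exists n₁ b
  with ℕ.s≤s (ℕ.s≤s {n = u} _) ← roundUp-exceeds {ℕ.suc n₁} {q = q} {q′ = 1}
                                    (subst (ℕ._< b) (sym (ℕₚ.*-identityˡ _)) n<b) b+r≡q*n =
  i₀ , r , ℕₚ.∸-monoʳ-≤ h (ℕ.s≤s (ℕ.s≤s ℕ.z≤n)) , ℕ.s≤s⁻¹ r<n ,
  b≡[h-i₀]*n-r , unique ,
  m , subst (λ h → HasSize (sumset h A) m) (sym h≡)
          (sumset-size-overlapping 1+u*n<b b≤2+u*n (ℕ.suc i₀)) ,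
  overlappingSize-closed n b i₀ u h≡
  where
  n : ℕ
  n = ℕ.suc n₁
  open IntervalWithPoint n b
  q≤h : ℕ.suc (ℕ.suc u) ≤ h
  q≤h = roundUp-minimal {q = ℕ.suc (ℕ.suc u)} r<n b+r≡q*n b≤h*n
  i₀ : ℕ
  i₀ = h ∸ ℕ.suc (ℕ.suc u)
  i₀≤h : i₀ ≤ h
  i₀≤h = ℕₚ.m∸n≤m h (ℕ.suc (ℕ.suc u))
  m : ℕ
  m = ℕ.suc (ℕ.suc i₀ ℕ.* b ℕ.+ ℕ.suc u ℕ.* n) ℕ.+ separatedSize n u
  h≡ : h ≡ ℕ.suc i₀ ℕ.+ ℕ.suc u
  h≡ = trans (sym (ℕₚ.m∸n+n≡m q≤h)) (ℕₚ.+-suc i₀ (ℕ.suc u))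
  b+r≡[h∸i₀]*n : b ℕ.+ r ≡ (h ∸ i₀) ℕ.* n
  b+r≡[h∸i₀]*n = subst (λ t → b ℕ.+ r ≡ t ℕ.* n) (sym (ℕₚ.m∸[m∸n]≡n q≤h)) b+r≡q*n
  1+u*n<b : ℕ.suc u ℕ.* n ℕ.< b
  1+u*n<b = roundUp-pred-below {q = ℕ.suc u} r<n b+r≡q*n
  b≤2+u*n : b ≤ ℕ.suc (ℕ.suc u) ℕ.* n
  b≤2+u*n = ℕₚ.≤-trans (ℕₚ.m≤m+n b r) (ℕₚ.≤-reflexive b+r≡q*n)
  b≡[h-i₀]*n-r : + b ≡ (+ h - + i₀) * + n - + r
  b≡[h-i₀]*n-r = from (representation⇔ i₀≤h) b+r≡[h∸i₀]*n
  unique : ∀ (i₀′ r′ : ℕ) → i₀′ ≤ h ∸ 2 → r′ ≤ n₁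
         → + b ≡ (+ h - + i₀′) * + n - + r′ → (i₀′ ≡ i₀) × (r′ ≡ r)
  unique i₀′ r′ i₀′≤h∸2 r′≤n₁ =
    representation-unique (ℕₚ.≤-trans i₀′≤h∸2 (ℕₚ.m∸n≤m h 2)) i₀≤h (ℕ.s≤s r′≤n₁) r<n b≡[h-i₀]*n-r

-- The hypothesis 2 ≤ h is not needed: in the second case n < b ≤ h n already forces it.
mainTheorem7 : (h k : ℕ) → 2 ≤ h → 3 ≤ k → (b : ℤ) →
    ((+ h * (+ k - + 2) < b) →
      ∃ λ (m : ℕ) → HasSize (sumset h (Interval (+ 0) (+ k - + 2) ∪ ｛ b ｝)) m
        × + 2 * + m ≡ (+ h + + 1) * (+ 2 + + h * (+ k - + 2)))
  × ((+ k - + 1 ≤ℤ b) → (b ≤ℤ + h * (+ k - + 2)) →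
      ∃ λ (i₀ : ℕ) → ∃ λ (r : ℕ) →
        (i₀ ≤ h ∸ 2) × (r ≤ k ∸ 3)
        × b ≡ (+ h - + i₀) * (+ k - + 2) - + r
        × (∀ (i₀′ r′ : ℕ) → i₀′ ≤ h ∸ 2 → r′ ≤ k ∸ 3
             → b ≡ (+ h - + i₀′) * (+ k - + 2) - + r′ → (i₀′ ≡ i₀) × (r′ ≡ r))
        × ∃ λ (m : ℕ) → HasSize (sumset h (Interval (+ 0) (+ k - + 2) ∪ ｛ b ｝)) m
            × + 2 * + m ≡ + 2 * (+ i₀ + + 1) * b + + 2 * (+ h - + i₀) * (+ h * (+ k - + 2) + + 1)
                           - (+ h + + i₀ + + 1) * (+ h - + i₀) * (+ k - + 2))
mainTheorem7 h (ℕ.suc (ℕ.suc (ℕ.suc n₁))) _ (ℕ.s≤s (ℕ.s≤s (ℕ.s≤s ℕ.z≤n))) b =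
  (λ h*n<b → separated-case h n b (subst (_< b) (sym (pos-* h n)) h*n<b)) ,
  (λ n<b b≤h*n → overlapping-case h n₁ b n<b (subst (b ≤ℤ_) (sym (pos-* h n)) b≤h*n))
  where
  n : ℕ
  n = ℕ.suc n₁
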